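{- For every $n\ge1$, the relation $\Omega_n$ on $\mathcal{D}_n$ is a partial order; that is, defining $u\le w$ iff $u=w$ or $u<_{\Omega_n}w$, the relation $\le$ is reflexive, antisymmetric and transitive.
   Context: $\mathcal{D}_n$ is the set of Dyck paths of length $2n$, i.e. words $w=a_1\cdots a_{2n}$ in letters $v,h$ with $n$ of each such that every prefix has at least as many $v$'s as $h$'s. For $1\le i\le 2n-2$ define $s_i:\mathcal{D}_n\to\mathcal{D}_n$ by $s_i(w)=a_1\cdots a_{i-1}\,vhv\,a_{i+3}\cdots a_{2n}$ if $a_ia_{i+1}a_{i+2}=vvh$; $s_i(w)=a_1\cdots a_{i-1}\,hvh\,a_{i+3}\cdots a_{2n}$ if $a_ia_{i+1}a_{i+2}=hhv$; and $s_i(w)=w$ otherwise. Let $S=\{s_1,\dots,s_{2n-2}\}$. Define $u<_{\Omega_n}w$ iff $u\ne w$ and $u=\sigma_1\sigma_2\cdots\sigma_k(w)$ for some $k\ge1$ and $\sigma_1,\dots,\sigma_k\in S$. -}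

module Defs where

open import Data.Nat using (ℕ; zero; suc; _+_; _*_; _∸_; _≤_; _<_)
open import Data.List using (List; []; _∷_; length; take; filter)
open import Data.Product using (Σ; _×_; _,_; proj₁)
open import Relation.Binary.PropositionalEquality using (_≡_)
open import Relation.Nullary using (¬_)
open import Relation.Nullary.Decidable using (yes; no)
open import Data.List.Relation.Unary.All using (All)

-- letters v (up step) and h (east step)
data Letter : Set where
  v h : Letter

Word : Set
Word = List Letter

#v : Word → ℕ
#v [] = 0
#v (v ∷ w) = suc (#v w)
#v (h ∷ w) = #v w

#h : Word → ℕ
#h [] = 0
#h (v ∷ w) = #h w
#h (h ∷ w) = suc (#h w)

IsDyck : ℕ → Word → Set
IsDyck n w = (#v w ≡ n) × (#h w ≡ n) × (∀ k → #h (take k w) ≤ #v (take k w))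

Dyck : ℕ → Set
Dyck n = Σ Word (IsDyck n)

-- s at 1-based position i applied to a word: rewriting at letters i,i+1,i+2
-- (sAt0 uses 0-based position)
sAt0 : ℕ → Word → Word
sAt0 zero (v ∷ v ∷ h ∷ w) = v ∷ h ∷ v ∷ w
sAt0 zero (h ∷ h ∷ v ∷ w) = h ∷ v ∷ h ∷ w
sAt0 zero w = w
sAt0 (suc i) [] = []
sAt0 (suc i) (a ∷ w) = a ∷ sAt0 i w

s : ℕ → Word → Word
s i w = sAt0 (i ∸ 1) w

applyAll : List ℕ → Word → Word
applyAll [] w = w
applyAll (i ∷ is) w = s i (applyAll is w)

ValidIndex : ℕ → ℕ → Set
ValidIndex n i = (1 ≤ i) × (i ≤ 2 * n ∸ 2)

_<Ω[_]_ : Word → ℕ → Word → Set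
u <Ω[ n ] w = ¬ (u ≡ w) × Σ (List ℕ) (λ is →
   (1 ≤ length is) × All (ValidIndex n) is × (u ≡ applyAll is w))

data _≤Ω[_]_ {n : ℕ} (u : Dyck n) : ℕ → Dyck n → Set where
  eqΩ : ∀ {w} → proj₁ u ≡ proj₁ w → u ≤Ω[ n ] w
  ltΩ : ∀ {w} → proj₁ u <Ω[ n ] proj₁ w → u ≤Ω[ n ] w

module Submission where

-- Record, for each letter of a word, whether it differs from the letter before it.
-- A move vvh ↦ vhv or hhv ↦ hvh changes this turn sequence only at the two
-- positions after i, from (no turn, turn) to (turn, turn), so every effective move
-- strictly increases the turn sequence lexicographically. Hence a word is never
-- strictly below itself, and chains of moves compose to chains of moves.

open import Defs
open import Data.Nat using (ℕ; _≤_; _∸_; zero; suc; s≤s; z≤n)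
open import Data.Bool using (Bool; true; false; f<t)
import Data.Bool.Base as Bool
import Data.Bool.Properties as BoolP
open import Data.List using (List; []; _∷_; _++_)
open import Data.List.Relation.Binary.Lex.Strict using (Lex-<; this; next; <-isStrictPartialOrder)
import Data.List.Relation.Binary.Pointwise as Pointwise
open import Data.List.Relation.Unary.All.Properties using (++⁺)
open import Data.Product using (_×_; proj₁; _,_)
open import Data.Sum using (_⊎_; inj₁; inj₂)
open import Data.Empty using (⊥-elim)
open import Relation.Nullary using (¬_)
open import Relation.Binary.Structures using (IsStrictPartialOrder)
open import Relation.Binary.PropositionalEquality using (_≡_; refl; sym; trans; cong; subst)

differ : Letter → Letter → Bool
differ v v = false
differ h h = false
differ _ _ = true

turnsAfter : Letter → Word → List Bool
turnsAfter a [] = []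
turnsAfter a (b ∷ w) = differ a b ∷ turnsAfter b w

_<ᴸ_ : List Bool → List Bool → Set
_<ᴸ_ = Lex-< _≡_ (Bool._<_)

module <ᴸ = IsStrictPartialOrder (<-isStrictPartialOrder BoolP.<-isStrictPartialOrder)

<ᴸ-irrefl : ∀ {xs} → ¬ (xs <ᴸ xs)
<ᴸ-irrefl = <ᴸ.irrefl (Pointwise.refl refl)

-- The letter in front of the word is arbitrary; it only has to be the same on both sides.
_≺_ : Word → Word → Set
u ≺ w = turnsAfter v u <ᴸ turnsAfter v w

sAt0-fixed-or-turns-< : ∀ i a w → sAt0 i w ≡ w ⊎ turnsAfter a w <ᴸ turnsAfter a (sAt0 i w)
sAt0-fixed-or-turns-< zero a (v ∷ v ∷ h ∷ w) = inj₂ (next refl (this f<t))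
sAt0-fixed-or-turns-< zero a (h ∷ h ∷ v ∷ w) = inj₂ (next refl (this f<t))
sAt0-fixed-or-turns-< zero a [] = inj₁ refl
sAt0-fixed-or-turns-< zero a (v ∷ []) = inj₁ refl
sAt0-fixed-or-turns-< zero a (h ∷ []) = inj₁ refl
sAt0-fixed-or-turns-< zero a (v ∷ v ∷ []) = inj₁ refl
sAt0-fixed-or-turns-< zero a (v ∷ h ∷ []) = inj₁ refl
sAt0-fixed-or-turns-< zero a (h ∷ v ∷ []) = inj₁ refl
sAt0-fixed-or-turns-< zero a (h ∷ h ∷ []) = inj₁ refl
sAt0-fixed-or-turns-< zero a (v ∷ v ∷ v ∷ w) = inj₁ refl
sAt0-fixed-or-turns-< zero a (v ∷ h ∷ _ ∷ w) = inj₁ refl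
sAt0-fixed-or-turns-< zero a (h ∷ v ∷ _ ∷ w) = inj₁ refl
sAt0-fixed-or-turns-< zero a (h ∷ h ∷ h ∷ w) = inj₁ refl
sAt0-fixed-or-turns-< (suc i) a [] = inj₁ refl
sAt0-fixed-or-turns-< (suc i) a (b ∷ w) with sAt0-fixed-or-turns-< i b w
... | inj₁ fixed = inj₁ (cong (b ∷_) fixed)
... | inj₂ turns< = inj₂ (next refl turns<)

applyAll-fixed-or-≺ : ∀ is w → applyAll is w ≡ w ⊎ w ≺ applyAll is w
applyAll-fixed-or-≺ [] w = inj₁ refl
applyAll-fixed-or-≺ (i ∷ is) w
  with applyAll is w | applyAll-fixed-or-≺ is w | sAt0-fixed-or-turns-< (i ∸ 1) v (applyAll is w)
... | u | inj₁ refl | inj₁ fixed = inj₁ fixed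
... | u | inj₁ refl | inj₂ u≺su = inj₂ u≺su
... | u | inj₂ w≺u  | inj₁ fixed = inj₂ (subst (w ≺_) (sym fixed) w≺u)
... | u | inj₂ w≺u  | inj₂ u≺su = inj₂ (<ᴸ.trans w≺u u≺su)

<Ω⇒≻ : ∀ n {u w} → u <Ω[ n ] w → w ≺ u
<Ω⇒≻ n {w = w} (u≢w , is , _ , _ , u≡is·w) with applyAll-fixed-or-≺ is w
... | inj₁ fixed = ⊥-elim (u≢w (trans u≡is·w fixed))
... | inj₂ w≺is·w = subst (w ≺_) (sym u≡is·w) w≺is·w

<Ω-asym : ∀ n {u w} → u <Ω[ n ] w → ¬ (w <Ω[ n ] u)
<Ω-asym n u<w w<u = <ᴸ-irrefl (<ᴸ.trans (<Ω⇒≻ n w<u) (<Ω⇒≻ n u<w))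

applyAll-++ : ∀ is js w → applyAll (is ++ js) w ≡ applyAll is (applyAll js w)
applyAll-++ [] js w = refl
applyAll-++ (i ∷ is) js w = cong (s i) (applyAll-++ is js w)

<Ω-trans : ∀ n {u w x} → u <Ω[ n ] w → w <Ω[ n ] x → u <Ω[ n ] x
<Ω-trans n {u} {w} {x} u<w@(_ , i ∷ is , _ , valid₁ , u≡is·w) w<x@(_ , js , _ , valid₂ , w≡js·x) =
  u≢x , i ∷ is ++ js , s≤s z≤n , ++⁺ valid₁ valid₂ , u≡is++js·x
  where
  u≢x : ¬ (u ≡ x)
  u≢x refl = <Ω-asym n u<w w<x
  u≡is++js·x : u ≡ applyAll (i ∷ is ++ js) x
  u≡is++js·x = trans u≡is·w (trans (cong (applyAll (i ∷ is)) w≡js·x) (sym (applyAll-++ (i ∷ is) js x)))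

lemma3p4 : (n : ℕ) → 1 ≤ n →
    ((u : Dyck n) → u ≤Ω[ n ] u)
    × ((u w : Dyck n) → u ≤Ω[ n ] w → w ≤Ω[ n ] u → proj₁ u ≡ proj₁ w)
    × ((u w x : Dyck n) → u ≤Ω[ n ] w → w ≤Ω[ n ] x → u ≤Ω[ n ] x)
lemma3p4 n _ = (λ u → eqΩ refl) , antisym , transitive
  where
  antisym : (u w : Dyck n) → u ≤Ω[ n ] w → w ≤Ω[ n ] u → proj₁ u ≡ proj₁ w
  antisym u w (eqΩ u≡w) _ = u≡w
  antisym u w (ltΩ _) (eqΩ w≡u) = sym w≡u
  antisym u w (ltΩ u<w) (ltΩ w<u) = ⊥-elim (<Ω-asym n u<w w<u)

  transitive : (u w x : Dyck n) → u ≤Ω[ n ] w → w ≤Ω[ n ] x → u ≤Ω[ n ] x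
  transitive u w x (eqΩ u≡w) (eqΩ w≡x) = eqΩ (trans u≡w w≡x)
  transitive u w x (eqΩ u≡w) (ltΩ w<x) = ltΩ (subst (_<Ω[ n ] proj₁ x) (sym u≡w) w<x)
  transitive u w x (ltΩ u<w) (eqΩ w≡x) = ltΩ (subst (proj₁ u <Ω[ n ]_) w≡x u<w)
  transitive u w x (ltΩ u<w) (ltΩ w<x) = ltΩ (<Ω-trans n u<w w<x)
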